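{- Let $p$ be an odd prime, $q=p^k$, let $0<\kappa\le k-1$, and let $\mathcal{O}_\kappa$ be a thin Galois orbit of primitive Dirichlet characters modulo $q$. For any integer $n$, $\sum_{\chi\in\mathcal{O}_\kappa}\chi(n)=0$ unless $n^{p-1}\equiv 1\pmod{p^{\tilde\kappa+1}}$, where $\tilde\kappa=\min(\kappa,k-2)$.
   Context: Let $\xi$ be a primitive $\phi(q)$-th root of unity. $\mathrm{Gal}(\mathbb{Q}(\xi)/\mathbb{Q})$ acts on primitive Dirichlet characters mod $q$ by $\chi^{\sigma}(n)=\sigma(\chi(n))$; its orbits are Galois orbits. For $0\le\kappa\le k-1$ let $K_{k-1-\kappa}=\mathbb{Q}(\xi^{p^\kappa})$; the subgroup $\mathrm{Gal}(\mathbb{Q}(\xi)/K_{k-1-\kappa})$ acts on each Galois orbit, and an orbit of this restricted action is a thin Galois orbit $\mathcal{O}_\kappa$. -}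

module Defs where

open import Level using (Level)
open import Algebra.Bundles using (CommutativeRing)
open import Data.Nat as ℕ using (ℕ; zero; suc; _∸_; _<_; _≤_)
open import Data.Nat.Coprimality using (Coprime)
open import Data.Integer as ℤ using (ℤ; +_)
open import Data.Integer.Divisibility as ℤD using ()
open import Data.List using (List; foldr; map)
open import Data.List.Relation.Unary.All using (All)
open import Data.List.Relation.Unary.Any using (Any)
open import Data.List.Relation.Unary.AllPairs using (AllPairs)
open import Data.Product using (Σ; ∃; _×_)
open import Data.Sum using (_⊎_)
open import Relation.Nullary using (¬_)
open import Relation.Binary.PropositionalEquality using (_≡_)

phiPrimePower : ℕ → ℕ → ℕ
phiPrimePower p k = p ℕ.^ (k ∸ 1) ℕ.* (p ∸ 1)

-- The Galois group Gal(Q(ξ)/Q), ξ a primitive m-th root of unity, is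
-- (Z/m)^×, a acting by ξ ↦ ξ^a. The subgroup Gal(Q(ξ)/Q(ξ^(p^κ))) consists
-- of the a with a ≡ 1 mod m/p^κ, where m/p^κ = p^(k-1-κ) (p-1).
-- (Represented by natural-number representatives a.)
InThinGalSubgroup : (p k κ : ℕ) → ℕ → Set
InThinGalSubgroup p k κ a =
  Coprime a (phiPrimePower p k) ×
  ∃ λ t → a ≡ suc (t ℕ.* (p ℕ.^ (k ∸ 1 ∸ κ) ℕ.* (p ∸ 1)))

module _ {c ℓ : Level} (R : CommutativeRing c ℓ) where
  open CommutativeRing R

  pow : Carrier → ℕ → Carrier
  pow x zero = 1#
  pow x (suc n) = x * pow x n

  natCast : ℕ → Carrier
  natCast zero = 0#
  natCast (suc n) = 1# + natCast n

  IsIntegralDomain : Set (c Level.⊔ ℓ)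
  IsIntegralDomain = (¬ (1# ≈ 0#)) × (∀ x y → x * y ≈ 0# → x ≈ 0# ⊎ y ≈ 0#)

  CharZero : Set ℓ
  CharZero = ∀ n → ¬ (natCast (suc n) ≈ 0#)

  IsPrimitiveRootOfUnity : ℕ → Carrier → Set ℓ
  IsPrimitiveRootOfUnity m ξ =
    pow ξ m ≈ 1# × (∀ d → 0 < d → d < m → ¬ (pow ξ d ≈ 1#))

  IsDirichletChar : (p k : ℕ) → (ℤ → Carrier) → Set ℓ
  IsDirichletChar p k χ =
    (∀ n → χ (n ℤ.+ (+ (p ℕ.^ k))) ≈ χ n) ×
    (∀ a b → χ (a ℤ.* b) ≈ χ a * χ b) ×
    (χ (+ 1) ≈ 1#) ×
    (∀ n → (+ p) ℤD.∣ n → χ n ≈ 0#) ×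
    (∀ n → ¬ ((+ p) ℤD.∣ n) → ¬ (χ n ≈ 0#))

  -- χ mod p^k is primitive: it is not induced from any proper divisor
  -- p^j (j < k) of the modulus, i.e. for each such j there is n coprime
  -- to p with n ≡ 1 mod p^j and χ(n) ≠ 1.
  IsPrimitiveChar : (p k : ℕ) → (ℤ → Carrier) → Set ℓ
  IsPrimitiveChar p k χ =
    IsDirichletChar p k χ ×
    (∀ j → j < k →
      ¬ (∀ n → ¬ ((+ p) ℤD.∣ n) → (+ (p ℕ.^ j)) ℤD.∣ (n ℤ.- + 1) → χ n ≈ 1#))

  -- Galois conjugate χ^σ_a for σ_a : ξ ↦ ξ^a; since every value of χ is 0
  -- or an m-th root of unity ζ, σ_a(ζ) = ζ^a.
  galAct : ℕ → (ℤ → Carrier) → (ℤ → Carrier)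
  galAct a χ n = pow (χ n) a

  _≈χ_ : (ℤ → Carrier) → (ℤ → Carrier) → Set ℓ
  χ ≈χ ψ = ∀ n → χ n ≈ ψ n

  InThinOrbit : (p k κ : ℕ) → (ℤ → Carrier) → (ℤ → Carrier) → Set ℓ
  InThinOrbit p k κ χ0 ψ = ∃ λ a → InThinGalSubgroup p k κ a × (ψ ≈χ galAct a χ0)

  EnumeratesThinOrbit : (p k κ : ℕ) → (ℤ → Carrier) → List (ℤ → Carrier) → Set (c Level.⊔ ℓ)
  EnumeratesThinOrbit p k κ χ0 L =
    All (InThinOrbit p k κ χ0) L ×
    (∀ ψ → InThinOrbit p k κ χ0 ψ → Any (λ φ → φ ≈χ ψ) L) ×
    AllPairs (λ φ ψ → ¬ (φ ≈χ ψ)) L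

  sumAt : List (ℤ → Carrier) → ℤ → Carrier
  sumAt L n = foldr _+_ 0# (map (λ χ → χ n) L)

module Submission where

open import Defs
open import Level using (Level)
open import Algebra.Bundles using (CommutativeRing)
open import Data.Nat as ℕ using (ℕ; _∸_; _<_; _⊓_)
open import Data.Nat.Primality using (Prime)
open import Data.Nat.Divisibility as ℕD using ()
open import Data.Integer as ℤ using (ℤ; +_)
open import Data.Integer.Divisibility as ℤD using ()
open import Data.List using (List)
open import Relation.Nullary using (¬_)

-- If p ∣ n every term vanishes. Otherwise O_κ = {χ0^a : a ∈ H}, H = {a ≡ 1 mod m} in
-- (ℤ/φ)^×, φ = φ(p^k), m = p^(k-1-κ)(p-1). For M = p^(k-1-K)(p-1) and L = p^K we have
-- M L = φ and m ∣ M, so each 1 + jM lies in H; as ψ ↦ ψ^(1+jM) permutes O_κ,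
-- L Σ_ψ ψ(n) = Σ_ψ ψ(n) Σ_{j<L} (ψ(n)^M)^j. Each geometric sum vanishes because ψ(n)^M
-- is an L-th root of unity other than 1: for ψ = χ0 because, by lifting the exponent,
-- a p-power of n^M generates (1 + p^(k-1)ℤ)/(1 + p^k ℤ), on which the primitive χ0 is
-- not trivial; for ψ = χ0^a because a is invertible mod φ. Characteristic zero ends it.

-- Integer arithmetic modulo a prime p and its powers.
module IntegerArithmetic where

  open import Data.Nat using (zero; suc; _!)
  import Data.Nat.Properties as ℕP
  open ℕD using (divides)
  open import Data.Nat.Primality using (euclidsLemma; prime⇒nonTrivial; prime⇒nonZero)
  open import Data.Nat.Combinatorics
    using (_C_; nCn≡1; nC1≡n; nCk+nC[k+1]≡[n+1]C[k+1]; nCk≡n!/k![n-k]!; k![n∸k]!∣n!)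
  open import Data.Nat.DivMod using (m*[n/m]≡n)
  open import Data.Fin as Fin using (Fin; toℕ; fromℕ; inject₁)
  import Data.Fin.Properties as FinP
  open import Data.Integer using (-[1+_]; _+_; _*_; -_; _-_; _^_; 1ℤ; 0ℤ)
  import Data.Integer.Properties as ℤP
  open import Data.Integer.DivMod using (a≡a%ℕn+[a/ℕn]*n)
  open import Data.Integer.Divisibility.Signed
    using (_∣_; _∣?_; divides; ∣-refl; ∣ᵤ⇒∣; ∣⇒∣ᵤ; ∣m∣n⇒∣m+n; ∣m∣n⇒∣m-n; ∣m⇒∣-m; ∣n⇒∣m*n; ∣m⇒∣m*n)
  open import Data.Integer.Tactic.RingSolver using (solve-∀)
  open import Data.Nat.Tactic.RingSolver using () renaming (solve-∀ to ℕ-solve-∀)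
  open import Data.Vec.Functional using (Vector)
  open import Data.Sum using (_⊎_; inj₁; inj₂)
  open import Data.Product using (Σ; ∃; _×_; _,_; proj₁; proj₂)
  open import Data.Empty using (⊥-elim)
  open import Relation.Nullary using (yes; no)
  open import Relation.Binary.PropositionalEquality

  import Algebra.Properties.CommutativeSemiring.Binomial ℤP.+-*-commutativeSemiring as Binomial
  open import Algebra.Properties.Semiring.Sum ℤP.+-*-semiring using (sum; sum-init-last)
  import Algebra.Properties.Semiring.Exp ℤP.+-*-semiring as SemiringExp
  open import Algebra.Properties.Semiring.Mult ℤP.+-*-semiring using () renaming (_×_ to _×ᵣ_)

  ∣-zero : ∀ d → d ∣ 0ℤ
  ∣-zero d = divides 0ℤ refl

  move-right : ∀ {a b c} → a ≡ b + c → b ≡ a - c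
  move-right {b = b} {c} refl = identity b c
    where identity : ∀ b c → b ≡ b + c - c
          identity = solve-∀

  move-left : ∀ {a b c} → a - c ≡ b → a ≡ b + c
  move-left {a} {c = c} refl = identity a c
    where identity : ∀ a c → a ≡ a - c + c
          identity = solve-∀

  ^-semiring : ∀ x n → x SemiringExp.^ n ≡ x ^ n
  ^-semiring x zero = refl
  ^-semiring x (suc n) = cong (x *_) (^-semiring x n)

  ×ᵣ≡* : ∀ n x → n ×ᵣ x ≡ + n * x
  ×ᵣ≡* zero x = sym (ℤP.*-zeroˡ x)
  ×ᵣ≡* (suc n) x = trans (cong (λ y → x + y) (×ᵣ≡* n x)) (sym (ℤP.suc-* (+ n) x))

  pos-^ : ∀ m e → + (m ℕ.^ e) ≡ (+ m) ^ e
  pos-^ m zero = refl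
  pos-^ m (suc e) = trans (ℤP.pos-* m (m ℕ.^ e)) (cong (+ m *_) (pos-^ m e))

  ∣-sum : ∀ {d n} (t : Vector ℤ n) → (∀ i → d ∣ t i) → d ∣ sum t
  ∣-sum {d} {zero} t _ = ∣-zero d
  ∣-sum {n = suc n} t d∣t = ∣m∣n⇒∣m+n (d∣t Fin.zero) (∣-sum (λ i → t (Fin.suc i)) (λ i → d∣t (Fin.suc i)))

  sum-ends : ∀ {n} (t : Vector ℤ (suc (suc n))) →
             sum t ≡ t Fin.zero + sum (λ i → t (Fin.suc (inject₁ i))) + t (fromℕ (suc n))
  sum-ends t = trans (cong (λ s → t Fin.zero + s) (sum-init-last (λ i → t (Fin.suc i))))
                     (sym (ℤP.+-assoc (t Fin.zero) _ _))

  freshman : ∀ {d} n x y → (∀ k → 0 ℕ.< k → k ℕ.< suc (suc n) → d ∣ + (suc (suc n) C k)) →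
             d ∣ (x + y) ^ suc (suc n) - x ^ suc (suc n) - y ^ suc (suc n)
  freshman {d} n x y d∣inner = subst (d ∣_) expansion (∣-sum inner d∣inner-terms)
    where
      m = suc (suc n)
      term : Vector ℤ (suc m)
      term = Binomial.binomialTerm x y m
      inner : Vector ℤ (suc n)
      inner i = term (Fin.suc (inject₁ i))
      first : term Fin.zero ≡ y ^ m
      first = trans (×ᵣ≡* 1 (1ℤ * y SemiringExp.^ m))
                    (trans (ℤP.*-identityˡ _) (trans (ℤP.*-identityˡ _) (^-semiring y m)))
      last : term (fromℕ m) ≡ x ^ m
      last = begin
          term (fromℕ m)
        ≡⟨ cong (λ k → (m C k) ×ᵣ (x SemiringExp.^ k * y SemiringExp.^ (m ∸ k))) (FinP.toℕ-fromℕ m) ⟩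
          (m C m) ×ᵣ (x SemiringExp.^ m * y SemiringExp.^ (m ∸ m))
        ≡⟨ cong₂ (λ c e → c ×ᵣ (x SemiringExp.^ m * y SemiringExp.^ e)) (nCn≡1 m) (ℕP.n∸n≡0 m) ⟩
          1 ×ᵣ (x SemiringExp.^ m * 1ℤ)
        ≡⟨ trans (×ᵣ≡* 1 _) (trans (ℤP.*-identityˡ _) (ℤP.*-identityʳ _)) ⟩
          x SemiringExp.^ m
        ≡⟨ ^-semiring x m ⟩
          x ^ m ∎
        where open ≡-Reasoning
      d∣inner-terms : ∀ i → d ∣ inner i
      d∣inner-terms i = subst (d ∣_) (sym (×ᵣ≡* (m C suc k) _))
        (∣m⇒∣m*n (Binomial.binomial x y m (Fin.suc (inject₁ i))) (d∣inner (suc k) ℕ.z<s (ℕ.s<s k<1+n)))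
        where k = toℕ (inject₁ i)
              k<1+n : k ℕ.< suc n
              k<1+n = subst (ℕ._< suc n) (sym (FinP.toℕ-inject₁ i)) (FinP.toℕ<n i)
      expansion : sum inner ≡ (x + y) ^ m - x ^ m - y ^ m
      expansion = trans (identity (y ^ m) (sum inner) (x ^ m)) (cong (λ X → X - x ^ m - y ^ m) (sym ends))
        where ends : (x + y) ^ m ≡ y ^ m + sum inner + x ^ m
              ends = trans (sym (^-semiring (x + y) m)) (trans (Binomial.theorem m x y)
                       (trans (sum-ends term) (cong₂ (λ a b → a + sum inner + b) first last)))
              identity : ∀ a s b → s ≡ a + s + b - b - a
              identity = solve-∀

  n∣n! : ∀ n → .{{ℕ.NonZero n}} → n ℕD.∣ n !
  n∣n! (suc n) = ℕD.m∣m*n (n !)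

  module PrimeModulus (p : ℕ) (p-prime : Prime p) where

    P : ℤ
    P = + p

    instance
      p-nonZero : ℕ.NonZero p
      p-nonZero = prime⇒nonZero p-prime

    euclid : ∀ a b → P ∣ a * b → P ∣ a ⊎ P ∣ b
    euclid a b P∣ab with euclidsLemma ℤ.∣ a ∣ ℤ.∣ b ∣ p-prime (subst (p ℕD.∣_) (ℤP.abs-* a b) (∣⇒∣ᵤ P∣ab))
    ... | inj₁ p∣a = inj₁ (∣ᵤ⇒∣ p∣a)
    ... | inj₂ p∣b = inj₂ (∣ᵤ⇒∣ p∣b)

    p∤m! : ∀ m → m ℕ.< p → ¬ p ℕD.∣ m !
    p∤m! zero _ p∣1 = ℕ.nonTrivial⇒≢1 {{prime⇒nonTrivial p-prime}} (ℕD.∣1⇒≡1 p∣1)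
    p∤m! (suc m) m<p p∣m! with euclidsLemma (suc m) (m !) p-prime p∣m!
    ... | inj₁ p∣m+1 = ℕP.<⇒≱ m<p (ℕD.∣⇒≤ p∣m+1)
    ... | inj₂ p∣m!' = p∤m! m (ℕP.<-trans (ℕP.n<1+n m) m<p) p∣m!'

    -- p divides the binomial coefficients p C k with 0 < k < p, since
    -- k! (p-k)! (p C k) = p! is divisible by p but neither k! nor (p-k)! is.
    p∣pCk : ∀ k → 0 ℕ.< k → k ℕ.< p → p ℕD.∣ p C k
    p∣pCk k 0<k k<p with euclidsLemma (k ! ℕ.* (p ∸ k) !) (p C k) p-prime p∣product
      where
        k≤p = ℕP.<⇒≤ k<p
        instance _ = ℕP._!*_!≢0 k (p ∸ k)
        product≡p! : k ! ℕ.* (p ∸ k) ! ℕ.* (p C k) ≡ p !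
        product≡p! = trans (cong (k ! ℕ.* (p ∸ k) ! ℕ.*_) (nCk≡n!/k![n-k]! k≤p)) (m*[n/m]≡n (k![n∸k]!∣n! k≤p))
        p∣product : p ℕD.∣ k ! ℕ.* (p ∸ k) ! ℕ.* (p C k)
        p∣product = subst (p ℕD.∣_) (sym product≡p!) (n∣n! p)
    ... | inj₂ p∣pCk = p∣pCk
    ... | inj₁ p∣k![p-k]! with euclidsLemma (k !) ((p ∸ k) !) p-prime p∣k![p-k]!
    ...   | inj₁ p∣k! = ⊥-elim (p∤m! k k<p p∣k!)
    ...   | inj₂ p∣[p-k]! = ⊥-elim (p∤m! (p ∸ k) (ℕP.∸-monoʳ-< 0<k (ℕP.<⇒≤ k<p)) p∣[p-k]!)

    -- A prime is at least 2; this lets the exponent p be unfolded.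
    p≡2+ : p ≡ suc (suc (p ∸ 2))
    p≡2+ = trans (sym (ℕP.m∸n+n≡m (ℕ.nonTrivial⇒n>1 p {{prime⇒nonTrivial p-prime}}))) (ℕP.+-comm (p ∸ 2) 2)

    0^p : 0ℤ ^ p ≡ 0ℤ
    0^p = subst (λ e → 0ℤ ^ e ≡ 0ℤ) (sym p≡2+) refl

    p-freshman : ∀ x y → P ∣ (x + y) ^ p - x ^ p - y ^ p
    p-freshman x y = subst (λ e → P ∣ (x + y) ^ e - x ^ e - y ^ e) (sym p≡2+)
      (freshman (p ∸ 2) x y (λ k 0<k k<p → ∣ᵤ⇒∣ (subst (λ e → p ℕD.∣ e C k) p≡2+
                                                    (p∣pCk k 0<k (subst (k ℕ.<_) (sym p≡2+) k<p)))))

    -- Fermat's little theorem x^p ≡ x mod p: by induction over ℕ, using the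
    -- freshman's dream for (1 + m)^p; for negative x from (x + (-x))^p = 0.
    fermat-ℕ : ∀ m → P ∣ (+ m) ^ p - + m
    fermat-ℕ zero = subst (P ∣_) (sym (cong (_- 0ℤ) 0^p)) (∣-zero P)
    fermat-ℕ (suc m) = subst (P ∣_) (trans (telescope ((1ℤ + + m) ^ p) ((+ m) ^ p) (+ m))
                                          (cong (λ z → z ^ p - z) (sym (ℤP.pos-+ 1 m))))
                         (∣m∣n⇒∣m+n (subst (λ o → P ∣ (1ℤ + + m) ^ p - o - (+ m) ^ p) (ℤP.^-zeroˡ p)
                                            (p-freshman 1ℤ (+ m)))
                                    (fermat-ℕ m))
      where telescope : ∀ A B m → A - 1ℤ - B + (B - m) ≡ A - (1ℤ + m)
            telescope = solve-∀

    fermat : ∀ x → P ∣ x ^ p - x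
    fermat (+ m) = fermat-ℕ m
    fermat x@(-[1+ m ]) = subst (P ∣_) (identity x (x ^ p) ((- x) ^ p))
                            (∣m∣n⇒∣m-n (∣m⇒∣-m (subst (λ z → P ∣ z - x ^ p - (- x) ^ p) x-x^p≡0 (p-freshman x (- x))))
                                       (fermat-ℕ (suc m)))
      where
        x-x^p≡0 : (x + - x) ^ p ≡ 0ℤ
        x-x^p≡0 = trans (cong (_^ p) (ℤP.+-inverseʳ x)) 0^p
        identity : ∀ x X Y → - (0ℤ - X - Y) - (Y - - x) ≡ X - x
        identity = solve-∀

    fermat-unit : ∀ x → ¬ P ∣ x → P ∣ x ^ (p ∸ 1) - 1ℤ
    fermat-unit x P∤x with euclid x (x ^ (p ∸ 1) - 1ℤ) (subst (P ∣_) factor (fermat x))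
      where factor : x ^ p - x ≡ x * (x ^ (p ∸ 1) - 1ℤ)
            factor = subst (λ e → x ^ e - x ≡ x * (x ^ (e ∸ 1) - 1ℤ)) (sym p≡2+) (identity x (x ^ suc (p ∸ 2)))
              where identity : ∀ x X → x * X - x ≡ x * (X - 1ℤ)
                    identity = solve-∀
    ... | inj₁ P∣x = ⊥-elim (P∤x P∣x)
    ... | inj₂ P∣x^[p-1]-1 = P∣x^[p-1]-1

  ∣-1⇒≡1+ : ∀ {a Q} → Q ∣ a - 1ℤ → ∃ λ q → a ≡ 1ℤ + Q * q
  ∣-1⇒≡1+ {a} {Q} (divides q eq) = q , trans (move-left eq) (trans (ℤP.+-comm (q * Q) 1ℤ) (cong (λ t → 1ℤ + t) (ℤP.*-comm q Q)))

  ≡1+⇒∣-1 : ∀ {a Q q} → a ≡ 1ℤ + Q * q → Q ∣ a - 1ℤ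
  ≡1+⇒∣-1 {a} {Q} {q} a≡ = divides q (trans (sym (move-right (trans a≡ (ℤP.+-comm 1ℤ (Q * q))))) (ℤP.*-comm Q q))

  expansion : ∀ d s → ∃ λ e → (1ℤ + d) ^ s ≡ 1ℤ + + s * d + d * d * (+ (s C 2) + d * e)
  expansion d zero = 0ℤ , identity d
    where identity : ∀ d → 1ℤ ≡ 1ℤ + 0ℤ * d + d * d * (0ℤ + d * 0ℤ)
          identity = solve-∀
  expansion d (suc s) with expansion d s
  ... | e , eq = c + e + d * e , (begin
      (1ℤ + d) * (1ℤ + d) ^ s
    ≡⟨ cong ((1ℤ + d) *_) eq ⟩
      (1ℤ + d) * (1ℤ + + s * d + d * d * (c + d * e))
    ≡⟨ step d (+ s) c e ⟩
      1ℤ + (1ℤ + + s) * d + d * d * ((+ s + c) + d * (c + e + d * e))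
    ≡⟨ cong₂ (λ a b → 1ℤ + a * d + d * d * (b + d * (c + e + d * e)))
             (sym (ℤP.pos-+ 1 s)) (sym (trans (cong +_ pascal) (ℤP.pos-+ s (s C 2)))) ⟩
      1ℤ + + suc s * d + d * d * (+ (suc s C 2) + d * (c + e + d * e)) ∎)
    where
      open ≡-Reasoning
      c = + (s C 2)
      pascal : suc s C 2 ≡ s ℕ.+ s C 2
      pascal = trans (sym (nCk+nC[k+1]≡[n+1]C[k+1] s 1)) (cong (ℕ._+ s C 2) (nC1≡n s))
      step : ∀ d s c e → (1ℤ + d) * (1ℤ + s * d + d * d * (c + d * e)) ≡
                         1ℤ + (1ℤ + s) * d + d * d * ((s + c) + d * (c + e + d * e))
      step = solve-∀

  shift-P : ∀ c Q P → c * Q * P ≡ c * (P * Q)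
  shift-P = solve-∀

  shift-P' : ∀ Q w P → Q * w * P ≡ P * Q * w
  shift-P' = solve-∀

  valuation : ∀ P B d → ¬ P ^ B ∣ d → ∃ λ j → ∃ λ w → j ℕ.< B × d ≡ P ^ j * w × ¬ P ∣ w
  valuation P zero d P⁰∤d = ⊥-elim (P⁰∤d (divides d (sym (ℤP.*-identityʳ d))))
  valuation P (suc B) d P^[1+B]∤d with P ∣? d
  ... | no P∤d = 0 , d , ℕ.z<s , sym (ℤP.*-identityˡ d) , P∤d
  ... | yes (divides q d≡qP) with valuation P B q P^B∤q
    where P^B∤q : ¬ P ^ B ∣ q
          P^B∤q (divides c q≡cP^B) =
            P^[1+B]∤d (divides c (trans d≡qP (trans (cong (_* P) q≡cP^B) (shift-P c (P ^ B) P))))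
  ... | j , w , j<B , q≡P^jw , P∤w =
        suc j , w , ℕ.s<s j<B , trans d≡qP (trans (cong (_* P) q≡P^jw) (shift-P' (P ^ j) w P)) , P∤w

  lift-factor : ∀ c P Q w e → c * P + P * Q * w * e ≡ P * (c + Q * w * e)
  lift-factor = solve-∀

  lift-regroup : ∀ P Q w T → 1ℤ + P * (P * Q * w) + (P * Q * w) * (P * Q * w) * (P * T) ≡
                             1ℤ + P * (P * Q) * (w + P * (Q * w * w * T))
  lift-regroup = solve-∀

  lift-quotient : ∀ w w' P z → w' - w + z * P ≡ w' + P * z - w
  lift-quotient = solve-∀

  unit-quotient : ∀ y w W q P → y - (y * W - q * P) * w ≡ - (y * (w * W - 1ℤ)) + q * P * w
  unit-quotient = solve-∀

  kernel-regroup : ∀ c P Q s w e →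
    ((c * P + s * w) * (P * Q) + 1ℤ) - (1ℤ + s * (P * Q * w) + (P * Q * w) * (P * Q * w) * e) ≡
    (c - Q * w * w * e) * (P * (P * Q))
  kernel-regroup = solve-∀

  level-shuffle : ∀ r d j → suc r ℕ.+ d ℕ.+ j ≡ r ℕ.+ (suc j ℕ.+ d)
  level-shuffle = ℕ-solve-∀

  cancel-difference : ∀ w w' → w' - (w' - w) ≡ w
  cancel-difference = solve-∀

  -- Powers of an odd prime p: lifting the exponent.
  module OddPrimePowers (p : ℕ) (p-prime : Prime p) (2<p : 2 ℕ.< p) where
    open PrimeModulus p p-prime public

    -- For odd p, p ∣ p C 2: the second-order term of (1 + d)^p is divisible by p d².
    p∣pC2 : ∃ λ c → + (p C 2) ≡ c * P
    p∣pC2 with p∣pCk 2 (ℕ.s≤s ℕ.z≤n) 2<p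
    ... | divides c eq = + c , trans (cong +_ eq) (ℤP.pos-* c p)

    lift : ∀ j w u → u ≡ 1ℤ + P ^ suc j * w → ∃ λ z → u ^ p ≡ 1ℤ + P ^ suc (suc j) * (w + P * z)
    lift j w u u≡ with expansion (P * P ^ j * w) p | p∣pC2
    ... | e , expand | c , pC2≡cP = Q * w * w * (c + Q * w * e) , (begin
        u ^ p
      ≡⟨ cong (_^ p) u≡ ⟩
        (1ℤ + P * Q * w) ^ p
      ≡⟨ expand ⟩
        1ℤ + P * (P * Q * w) + (P * Q * w) * (P * Q * w) * (+ (p C 2) + P * Q * w * e)
      ≡⟨ cong (λ t → 1ℤ + P * (P * Q * w) + (P * Q * w) * (P * Q * w) * t)
              (trans (cong (_+ P * Q * w * e) pC2≡cP) (lift-factor c P Q w e)) ⟩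
        1ℤ + P * (P * Q * w) + (P * Q * w) * (P * Q * w) * (P * (c + Q * w * e))
      ≡⟨ lift-regroup P Q w (c + Q * w * e) ⟩
        1ℤ + P * (P * Q) * (w + P * (Q * w * w * (c + Q * w * e))) ∎)
      where
        open ≡-Reasoning
        Q = P ^ j

    lift-iterated : ∀ i j w u → u ≡ 1ℤ + P ^ suc j * w →
                    ∃ λ w' → u ^ (p ℕ.^ i) ≡ 1ℤ + P ^ suc (i ℕ.+ j) * w' × P ∣ w' - w
    lift-iterated zero j w u u≡ = w , trans (ℤP.^-identityʳ u) u≡ , subst (P ∣_) (sym (ℤP.+-inverseʳ w)) (∣-zero P)
    lift-iterated (suc i) j w u u≡ =
      w' + P * z ,
      trans (cong (u ^_) (ℕP.*-comm p (p ℕ.^ i))) (trans (sym (ℤP.^-*-assoc u (p ℕ.^ i) p)) u^p^i^p≡) ,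
      subst (P ∣_) (lift-quotient w w' P z) (∣m∣n⇒∣m+n P∣w'-w (∣n⇒∣m*n z (∣-refl {P})))
      where
        previous = lift-iterated i j w u u≡
        w' = proj₁ previous
        u^p^i≡ = proj₁ (proj₂ previous)
        P∣w'-w = proj₂ (proj₂ previous)
        next = lift (i ℕ.+ j) w' (u ^ (p ℕ.^ i)) u^p^i≡
        z = proj₁ next
        u^p^i^p≡ = proj₂ next

    -- Euler's theorem for p^(k+1): x^(p^k (p-1)) ≡ 1 mod p^(k+1) for x prime to p,
    -- by lifting Fermat's x^(p-1) ≡ 1 mod p.
    euler : ∀ k x → ¬ P ∣ x → P ^ suc k ∣ x ^ (p ℕ.^ k ℕ.* (p ∸ 1)) - 1ℤ
    euler k x P∤x = ≡1+⇒∣-1 (begin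
        x ^ (p ℕ.^ k ℕ.* (p ∸ 1))
      ≡⟨ cong (x ^_) (ℕP.*-comm (p ℕ.^ k) (p ∸ 1)) ⟩
        x ^ ((p ∸ 1) ℕ.* p ℕ.^ k)
      ≡⟨ sym (ℤP.^-*-assoc x (p ∸ 1) (p ℕ.^ k)) ⟩
        (x ^ (p ∸ 1)) ^ (p ℕ.^ k)
      ≡⟨ lifted ⟩
        1ℤ + P ^ suc (k ℕ.+ 0) * w'
      ≡⟨ cong (λ e → 1ℤ + P ^ suc e * w') (ℕP.+-identityʳ k) ⟩
        1ℤ + P ^ suc k * w' ∎)
      where
        open ≡-Reasoning
        open Σ (∣-1⇒≡1+ {x ^ (p ∸ 1)} (fermat-unit x P∤x)) renaming (proj₁ to q; proj₂ to x^[p-1]≡)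
        x^[p-1]≡′ : x ^ (p ∸ 1) ≡ 1ℤ + P ^ 1 * q
        x^[p-1]≡′ = trans x^[p-1]≡ (cong (λ Q → 1ℤ + Q * q) (sym (ℤP.*-identityʳ P)))
        lifting = lift-iterated k 0 q (x ^ (p ∸ 1)) x^[p-1]≡′
        w' = proj₁ lifting
        lifted = proj₁ (proj₂ lifting)

    -- Division by a unit mod p: for w prime to p every y is ≡ s w mod p for some
    -- s ∈ ℕ, namely the residue of y w^(p-2), since w^(p-1) ≡ 1.
    divide-mod-p : ∀ w y → ¬ P ∣ w → ∃ λ s → P ∣ y - + s * w
    divide-mod-p w y P∤w = s , subst (P ∣_) (sym y-sw≡)
      (∣m∣n⇒∣m+n (∣m⇒∣-m (∣n⇒∣m*n y (subst (P ∣_) w^[p-1]≡ (fermat-unit w P∤w))))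
                 (∣m⇒∣m*n w (∣n⇒∣m*n q (∣-refl {P}))))
      where
        W = w ^ (p ∸ 2)
        s = (y * W) ℤ.%ℕ p
        q = (y * W) ℤ./ℕ p
        w^[p-1]≡ : w ^ (p ∸ 1) - 1ℤ ≡ w * W - 1ℤ
        w^[p-1]≡ = cong (_- 1ℤ) (subst (λ e → w ^ (e ∸ 1) ≡ w * w ^ (e ∸ 2)) (sym p≡2+) refl)
        division : y * W ≡ + s + q * P
        division = a≡a%ℕn+[a/ℕn]*n (y * W) p
        y-sw≡ : y - + s * w ≡ - (y * (w * W - 1ℤ)) + q * P * w
        y-sw≡ = trans (cong (λ t → y - t * w) (move-right {y * W} {+ s} {q * P} division)) (unit-quotient y w W q P)

    kernel-cyclic : ∀ k g w → ¬ P ∣ w → g ≡ 1ℤ + P ^ suc k * w →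
                    ∀ x → P ^ suc k ∣ x - 1ℤ → ∃ λ s → P ^ suc (suc k) ∣ x - g ^ s
    kernel-cyclic k g w P∤w g≡ x (divides y x-1≡) = s , divides (c - P ^ k * w * w * e) (begin
        x - g ^ s
      ≡⟨ cong₂ (λ a b → a - b ^ s) (move-left {x} {c = 1ℤ} x-1≡) g≡ ⟩
        (y * (P * P ^ k) + 1ℤ) - (1ℤ + P * P ^ k * w) ^ s
      ≡⟨ cong₂ (λ a b → (a * (P * P ^ k) + 1ℤ) - b) (move-left {y} {c = + s * w} y-sw≡) g^s≡ ⟩
        ((c * P + + s * w) * (P * P ^ k) + 1ℤ) - (1ℤ + + s * (P * P ^ k * w) + (P * P ^ k * w) * (P * P ^ k * w) * e)
      ≡⟨ kernel-regroup c P (P ^ k) (+ s) w e ⟩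
        (c - P ^ k * w * w * e) * (P * (P * P ^ k)) ∎)
      where
        open ≡-Reasoning
        open Σ (divide-mod-p w y P∤w) renaming (proj₁ to s; proj₂ to P∣y-sw)
        c = _∣_.quotient P∣y-sw
        y-sw≡ = _∣_.equality P∣y-sw
        open Σ (expansion (P ^ suc k * w) s) renaming (proj₁ to e'; proj₂ to g^s≡)
        e = + (s C 2) + P ^ suc k * w * e'

    -- If p ∤ n and p^(K+1) ∤ n^(p-1) - 1, then n^(p-1) ≡ 1 + p^(j+1) w with j < K
    -- and p ∤ w; raising it to the power p^(r+1+d), d = K - 1 - j, lands exactly
    -- at level p^(r+K+1), with a quotient still prime to p.
    kernel-generator : ∀ K r n → ¬ P ∣ n → ¬ P ^ suc K ∣ n ^ (p ∸ 1) - 1ℤ →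
      ∃ λ d → ∃ λ w → ¬ P ∣ w × n ^ (p ℕ.^ (suc r ℕ.+ d) ℕ.* (p ∸ 1)) ≡ 1ℤ + P ^ suc (r ℕ.+ K) * w
    kernel-generator K r n P∤n P^[1+K]∤ = from-valuation (valuation P (suc K) (n ^ (p ∸ 1) - 1ℤ) P^[1+K]∤)
      where
        u = n ^ (p ∸ 1)
        from-valuation : (∃ λ j → ∃ λ w → j ℕ.< suc K × u - 1ℤ ≡ P ^ j * w × ¬ P ∣ w) →
                         ∃ λ d → ∃ λ w → ¬ P ∣ w × n ^ (p ℕ.^ (suc r ℕ.+ d) ℕ.* (p ∸ 1)) ≡ 1ℤ + P ^ suc (r ℕ.+ K) * w
        from-valuation (zero , w , _ , u-1≡ , P∤w) =
          ⊥-elim (P∤w (subst (P ∣_) (trans u-1≡ (ℤP.*-identityˡ w)) (fermat-unit n P∤n)))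
        from-valuation (suc j , w , ℕ.s≤s j<K , u-1≡ , P∤w) = d , w' , P∤w' , (begin
            n ^ (p ℕ.^ i ℕ.* (p ∸ 1))
          ≡⟨ cong (n ^_) (ℕP.*-comm (p ℕ.^ i) (p ∸ 1)) ⟩
            n ^ ((p ∸ 1) ℕ.* p ℕ.^ i)
          ≡⟨ sym (ℤP.^-*-assoc n (p ∸ 1) (p ℕ.^ i)) ⟩
            u ^ (p ℕ.^ i)
          ≡⟨ lifted ⟩
            1ℤ + P ^ suc (i ℕ.+ j) * w'
          ≡⟨ cong (λ e → 1ℤ + P ^ suc e * w') level ⟩
            1ℤ + P ^ suc (r ℕ.+ K) * w' ∎)
          where
            open ≡-Reasoning
            open Σ (ℕP.m≤n⇒∃[o]m+o≡n j<K) renaming (proj₁ to d; proj₂ to j+1+d≡K)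
            i = suc r ℕ.+ d
            level : i ℕ.+ j ≡ r ℕ.+ K
            level = trans (level-shuffle r d j) (cong (r ℕ.+_) j+1+d≡K)
            u≡ : u ≡ 1ℤ + P ^ suc j * w
            u≡ = trans (move-left {u} {c = 1ℤ} u-1≡) (ℤP.+-comm (P ^ suc j * w) 1ℤ)
            lifting = lift-iterated i j w u u≡
            w' = proj₁ lifting
            lifted = proj₁ (proj₂ lifting)
            P∤w' : ¬ P ∣ w'
            P∤w' P∣w' = P∤w (subst (P ∣_) (cancel-difference w w') (∣m∣n⇒∣m-n P∣w' (proj₂ (proj₂ lifting))))

-- Commutative rings, finite sums, permutations of lists, and the action of a
-- thin subgroup on an orbit.
module RingsAndOrbits where

  open import Data.Nat using (zero; suc)
  import Data.Nat.Properties as ℕP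
  open import Data.Fin using (toℕ)
  open import Data.List using ([]; _∷_; _++_; foldr; map)
  open import Data.List.Relation.Unary.All as All using (All; []; _∷_)
  open import Data.List.Relation.Unary.Any as Any using (Any; here; there)
  open import Data.List.Relation.Unary.AllPairs as AllPairs using (AllPairs; []; _∷_)
  open import Relation.Binary.Bundles using (Setoid)
  open import Data.Product using (Σ; ∃; _×_; _,_; proj₁; proj₂)
  open import Data.Vec.Functional using (Vector)
  open import Data.Sum using (_⊎_; inj₁; inj₂)
  open import Data.Empty using (⊥-elim)
  open import Data.Maybe using (nothing)
  open import Relation.Binary.PropositionalEquality as ≡ using (_≡_; subst)
  import Tactic.RingSolver.Core.AlmostCommutativeRing as ACR

  -- Two duplicate-free lists with the same members (up to a setoid equality)
  -- are permutations of each other: match the head of the first list with its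
  -- occurrence in the second, shift that occurrence to the front and recurse.
  module SameMembers {a ℓ : Level} (S : Setoid a ℓ) where
    open Setoid S
    open import Data.List.Membership.Setoid S using (_∈_)
    open import Data.List.Membership.Setoid.Properties using (∈-∃++; ∈-resp-≈)
    open import Data.List.Relation.Unary.Unique.Setoid S using (Unique)
    open import Data.List.Relation.Binary.Permutation.Setoid S using (_↭_; ↭-refl; ↭-sym; ↭-trans; ↭-prep; ↭-reflexive-≋)
    open import Data.List.Relation.Binary.Permutation.Setoid.Properties S using (∈-resp-↭; All-resp-↭; Unique-resp-↭; shift)

    ∈⇒↭-front : ∀ {x ys} → x ∈ ys → ∃ λ zs → ys ↭ x ∷ zs
    ∈⇒↭-front x∈ys with ∈-∃++ S x∈ys
    ... | B , C , w , x≈w , ys≋ = B ++ C , ↭-trans (↭-reflexive-≋ ys≋) (shift (sym x≈w) B C)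

    same-members-↭ : ∀ {xs ys} → Unique xs → Unique ys → All (_∈ ys) xs → All (_∈ xs) ys → xs ↭ ys
    same-members-↭ {[]} {[]} _ _ _ _ = ↭-refl
    same-members-↭ {[]} {y ∷ ys} _ _ _ (() ∷ _)
    same-members-↭ {x ∷ xs} {ys} (x≉xs ∷ unique-xs) unique-ys (x∈ys ∷ xs⊆ys) ys⊆x∷xs =
      ↭-trans (↭-prep x (same-members-↭ unique-xs unique-zs xs⊆zs zs⊆xs)) (↭-sym ys↭x∷zs)
      where
        open Σ (∈⇒↭-front x∈ys) renaming (proj₁ to zs; proj₂ to ys↭x∷zs)
        unique-x∷zs : Unique (x ∷ zs)
        unique-x∷zs = Unique-resp-↭ ys↭x∷zs unique-ys
        unique-zs = AllPairs.tail unique-x∷zs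
        drop-head : ∀ {v l} → ¬ x ≈ v → v ∈ x ∷ l → v ∈ l
        drop-head x≉v (here v≈x) = ⊥-elim (x≉v (sym v≈x))
        drop-head x≉v (there v∈l) = v∈l
        -- Members of xs differ from x, so they lie in zs; members of zs differ
        -- from x, so they lie in xs.
        xs⊆zs : All (_∈ zs) xs
        xs⊆zs = All.zipWith (λ (x≉v , v∈ys) → drop-head x≉v (∈-resp-↭ ys↭x∷zs v∈ys)) (x≉xs , xs⊆ys)
        zs⊆xs : All (_∈ xs) zs
        zs⊆xs = All.zipWith (λ (x≉u , u∈x∷xs) → drop-head x≉u u∈x∷xs)
                  (AllPairs.head unique-x∷zs , All.tail (All-resp-↭ (∈-resp-≈ S) ys↭x∷zs ys⊆x∷xs))

  module RingFacts {c ℓ : Level} (R : CommutativeRing c ℓ) where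
    open CommutativeRing R
    open import Algebra.Properties.CommutativeSemiring.Exp commutativeSemiring
      using (_^_; ^-congˡ; ^-assocʳ; ^-homo-*)
    open import Algebra.Properties.Semiring.Sum semiring
      using (sum; sum-replicate; sum-replicate-zero; ∑-distrib-+; *-distribˡ-sum)
    open import Algebra.Properties.Semiring.Mult semiring using (×-congʳ; ×-assoc-*) renaming (_×_ to _×ᵣ_)
    open import Relation.Binary.Reasoning.Setoid setoid
    open import Tactic.RingSolver.NonReflective (ACR.fromCommutativeRing R (λ _ → nothing))
      using (solve; _⊜_; _⊕_; _⊗_; Κ)

    pow≡^ : ∀ x n → pow R x n ≡ x ^ n
    pow≡^ x zero = ≡.refl
    pow≡^ x (suc n) = ≡.cong (x *_) (pow≡^ x n)

    pow-cong : ∀ {x y} n → x ≈ y → pow R x n ≈ pow R y n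
    pow-cong {x} {y} n x≈y = begin
      pow R x n ≡⟨ pow≡^ x n ⟩ x ^ n ≈⟨ ^-congˡ n x≈y ⟩ y ^ n ≡⟨ ≡.sym (pow≡^ y n) ⟩ pow R y n ∎

    pow-assoc : ∀ x m n → pow R (pow R x m) n ≈ pow R x (m ℕ.* n)
    pow-assoc x m n = begin
      pow R (pow R x m) n ≡⟨ ≡.trans (pow≡^ (pow R x m) n) (≡.cong (_^ n) (pow≡^ x m)) ⟩
      (x ^ m) ^ n         ≈⟨ ^-assocʳ x m n ⟩
      x ^ (m ℕ.* n)       ≡⟨ ≡.sym (pow≡^ x (m ℕ.* n)) ⟩
      pow R x (m ℕ.* n)   ∎

    pow-+ : ∀ x m n → pow R x (m ℕ.+ n) ≈ pow R x m * pow R x n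
    pow-+ x m n = begin
      pow R x (m ℕ.+ n)       ≡⟨ pow≡^ x (m ℕ.+ n) ⟩
      x ^ (m ℕ.+ n)           ≈⟨ ^-homo-* x m n ⟩
      x ^ m * x ^ n           ≡⟨ ≡.sym (≡.cong₂ _*_ (pow≡^ x m) (pow≡^ x n)) ⟩
      pow R x m * pow R x n   ∎

    pow-one : ∀ n → pow R 1# n ≈ 1#
    pow-one zero = refl
    pow-one (suc n) = trans (*-identityˡ _) (pow-one n)

    natCast-* : ∀ n t → n ×ᵣ t ≈ natCast R n * t
    natCast-* n t = begin
      n ×ᵣ t          ≈⟨ ×-congʳ n (sym (*-identityˡ t)) ⟩
      n ×ᵣ (1# * t)   ≈⟨ sym (×-assoc-* n 1# t) ⟩
      (n ×ᵣ 1#) * t   ≡⟨ ≡.cong (_* t) (natCast≡× n) ⟩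
      natCast R n * t ∎
      where natCast≡× : ∀ n → n ×ᵣ 1# ≡ natCast R n
            natCast≡× zero = ≡.refl
            natCast≡× (suc n) = ≡.cong (λ t → 1# + t) (natCast≡× n)

    geometric : Carrier → (L : ℕ) → Carrier
    geometric y L = sum {L} (λ j → pow R y (toℕ j))

    geometric-identity : ∀ y L → y * geometric y L + 1# ≈ geometric y L + pow R y L
    geometric-identity y zero = +-congʳ (zeroʳ y)
    geometric-identity y (suc L) = begin
        y * geometric y (suc L) + 1#
      ≈⟨ +-congʳ (*-congˡ unfold) ⟩
        y * (1# + y * G) + 1#
      ≈⟨ solve 2 (λ y G → ((y ⊗ (Κ 1# ⊕ (y ⊗ G))) ⊕ Κ 1#) ⊜ (Κ 1# ⊕ (y ⊗ ((y ⊗ G) ⊕ Κ 1#)))) refl y G ⟩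
        1# + y * (y * G + 1#)
      ≈⟨ +-congˡ (*-congˡ (geometric-identity y L)) ⟩
        1# + y * (G + pow R y L)
      ≈⟨ solve 3 (λ y G t → (Κ 1# ⊕ (y ⊗ (G ⊕ t))) ⊜ ((Κ 1# ⊕ (y ⊗ G)) ⊕ (y ⊗ t))) refl y G (pow R y L) ⟩
        (1# + y * G) + y * pow R y L
      ≈⟨ +-congʳ (sym unfold) ⟩
        geometric y (suc L) + pow R y (suc L) ∎
      where
        G = geometric y L
        unfold : geometric y (suc L) ≈ 1# + y * G
        unfold = +-congˡ (sym (*-distribˡ-sum {L} y (λ j → pow R y (toℕ j))))

    RootOrZero : ℕ → Carrier → Set ℓ
    RootOrZero φ x = x ≈ 0# ⊎ pow R x φ ≈ 1#

    root-resp : ∀ {φ x y} → x ≈ y → RootOrZero φ x → RootOrZero φ y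
    root-resp x≈y (inj₁ x≈0) = inj₁ (trans (sym x≈y) x≈0)
    root-resp {φ} x≈y (inj₂ x^φ≈1) = inj₂ (trans (pow-cong φ (sym x≈y)) x^φ≈1)

    root-period : ∀ {φ x} → pow R x φ ≈ 1# → ∀ b c → pow R x (b ℕ.+ c ℕ.* φ) ≈ pow R x b
    root-period {φ} {x} x^φ≈1 b c = begin
      pow R x (b ℕ.+ c ℕ.* φ)       ≈⟨ pow-+ x b (c ℕ.* φ) ⟩
      pow R x b * pow R x (c ℕ.* φ) ≡⟨ ≡.cong (λ e → pow R x b * pow R x e) (ℕP.*-comm c φ) ⟩
      pow R x b * pow R x (φ ℕ.* c) ≈⟨ *-congˡ (sym (pow-assoc x φ c)) ⟩
      pow R x b * pow R (pow R x φ) c ≈⟨ *-congˡ (trans (pow-cong c x^φ≈1) (pow-one c)) ⟩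
      pow R x b * 1#                ≈⟨ *-identityʳ _ ⟩
      pow R x b                     ∎

    root-fixed : ∀ {φ x} → RootOrZero φ x → ∀ Y → pow R x (suc (Y ℕ.* φ)) ≈ x
    root-fixed {φ} {x} (inj₁ x≈0) Y = trans (*-congʳ x≈0) (trans (zeroˡ _) (sym x≈0))
    root-fixed {φ} {x} (inj₂ x^φ≈1) Y = trans (root-period x^φ≈1 1 Y) (*-identityʳ x)

    root-power : ∀ {φ x} → RootOrZero φ x → ∀ a → RootOrZero φ (pow R x (suc a))
    root-power (inj₁ x≈0) a = inj₁ (trans (*-congʳ x≈0) (zeroˡ _))
    root-power {φ} {x} (inj₂ x^φ≈1) a = inj₂ (begin
      pow R (pow R x (suc a)) φ   ≈⟨ pow-assoc x (suc a) φ ⟩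
      pow R x (suc a ℕ.* φ)       ≡⟨ ≡.cong (pow R x) (ℕP.*-comm (suc a) φ) ⟩
      pow R x (φ ℕ.* suc a)       ≈⟨ sym (pow-assoc x φ (suc a)) ⟩
      pow R (pow R x φ) (suc a)   ≈⟨ trans (pow-cong (suc a) x^φ≈1) (pow-one (suc a)) ⟩
      1#                          ∎)

    listSum : ∀ {a} {A : Set a} → (A → Carrier) → List A → Carrier
    listSum f xs = foldr _+_ 0# (map f xs)

    listSum-zero : ∀ {a} {A : Set a} {f : A → Carrier} {xs} → All (λ x → f x ≈ 0#) xs → listSum f xs ≈ 0#
    listSum-zero [] = refl
    listSum-zero (fx≈0 ∷ rest) = trans (+-cong fx≈0 (listSum-zero rest)) (+-identityˡ 0#)

    sum-listSum : ∀ {a} {A : Set a} L (g : Vector (A → Carrier) L) xs →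
                  sum {L} (λ j → listSum (g j) xs) ≈ listSum (λ x → sum {L} (λ j → g j x)) xs
    sum-listSum L g [] = sum-replicate-zero L
    sum-listSum L g (x ∷ xs) = trans (∑-distrib-+ (λ j → g j x) (λ j → listSum (g j) xs)) (+-congˡ (sum-listSum L g xs))

    module Domain (domain : IsIntegralDomain R) (char-zero : CharZero R) where
      open import Algebra.Properties.Ring ring using (-‿distribˡ-*; +-cancelʳ; x∙y⁻¹≈ε⇒x≈y)

      no-zero-divisors : ∀ x y → x * y ≈ 0# → x ≈ 0# ⊎ y ≈ 0#
      no-zero-divisors = proj₂ domain

      -- A root of unity y ≠ 1 of order dividing L has vanishing geometric sum:
      -- (y - 1) G = y^L - 1 = 0.
      geometric-vanishes : ∀ y L → pow R y L ≈ 1# → ¬ y ≈ 1# → geometric y L ≈ 0#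
      geometric-vanishes y L y^L≈1 y≉1 with no-zero-divisors (y - 1#) G [y-1]G≈0
        where
          G = geometric y L
          yG≈G : y * G ≈ G
          yG≈G = +-cancelʳ 1# (y * G) G (trans (geometric-identity y L) (+-congˡ y^L≈1))
          [y-1]G≈0 : (y - 1#) * G ≈ 0#
          [y-1]G≈0 = begin
            (y - 1#) * G         ≈⟨ distribʳ G y (- 1#) ⟩
            y * G + - 1# * G     ≈⟨ +-cong yG≈G (trans (sym (-‿distribˡ-* 1# G)) (-‿cong (*-identityˡ G))) ⟩
            G - G                ≈⟨ -‿inverseʳ G ⟩
            0#                   ∎
      ... | inj₂ G≈0 = G≈0
      ... | inj₁ y-1≈0 = ⊥-elim (y≉1 (x∙y⁻¹≈ε⇒x≈y y 1# y-1≈0))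

      natCast-cancel : ∀ L .{{_ : ℕ.NonZero L}} t → natCast R L * t ≈ 0# → t ≈ 0#
      natCast-cancel (suc L) t Lt≈0 with no-zero-divisors (natCast R (suc L)) t Lt≈0
      ... | inj₁ L≈0 = ⊥-elim (char-zero L L≈0)
      ... | inj₂ t≈0 = t≈0

  module Residues where
    open import Data.Nat.Divisibility using (_∣_; ∣-trans; ∣1⇒≡1; ∣m+n∣m⇒∣n; ∣n⇒∣m*n; ∣m⇒∣m*n; n∣m*n)
    open import Data.Nat.Coprimality as Coprime using (Coprime; coprime-divisor; coprime-Bézout)
    open import Data.Nat.GCD using (module Bézout)
    open import Data.Nat.Tactic.RingSolver using (solve-∀)

    coprime-*ʳ : ∀ {a m n} → Coprime a m → Coprime a n → Coprime a (m ℕ.* n)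
    coprime-*ʳ {a} {m} {n} a⊥m a⊥n {i} (i∣a , i∣mn) = a⊥n (i∣a , coprime-divisor i⊥m i∣mn)
      where i⊥m : Coprime i m
            i⊥m (j∣i , j∣m) = a⊥m (∣-trans j∣i i∣a , j∣m)

    coprime-^ʳ : ∀ {a m} → Coprime a m → ∀ e → Coprime a (m ℕ.^ e)
    coprime-^ʳ a⊥m zero (_ , i∣1) = ∣1⇒≡1 i∣1
    coprime-^ʳ a⊥m (suc e) = coprime-*ʳ a⊥m (coprime-^ʳ a⊥m e)

    coprime-*ˡ : ∀ {a b n} → Coprime a n → Coprime b n → Coprime (a ℕ.* b) n
    coprime-*ˡ a⊥n b⊥n = Coprime.sym (coprime-*ʳ (Coprime.sym a⊥n) (Coprime.sym b⊥n))

    coprime-1+ : ∀ j M d → d ∣ M → Coprime (suc (j ℕ.* M)) d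
    coprime-1+ j M d d∣M {i} (i∣1+jM , i∣d) =
      ∣1⇒≡1 (∣m+n∣m⇒∣n (subst (i ∣_) (ℕP.+-comm 1 (j ℕ.* M)) i∣1+jM) (∣n⇒∣m*n j (∣-trans i∣d d∣M)))

    invertible : ∀ b φ → 2 ℕ.≤ φ → Coprime b φ → ∃ λ X → ∃ λ Y → X ℕ.* b ≡ suc (Y ℕ.* φ)
    invertible b φ@(suc (suc f)) (ℕ.s≤s (ℕ.s≤s _)) b⊥φ with coprime-Bézout b⊥φ
    ... | Bézout.+- X Y eq = X , Y , ≡.sym eq
    ... | Bézout.-+ X zero ()
    ... | Bézout.-+ X (suc Y) eq = X ℕ.* suc f , Y ℕ.* suc f ℕ.+ f , flip (≡.cong (ℕ._* suc f) (ℕP.suc-injective eq))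
      where
        -- from 1 + X b = (Y + 1) φ, multiply by φ - 1 = f + 1.
        flip : X ℕ.* b ℕ.* suc f ≡ (suc f ℕ.+ Y ℕ.* φ) ℕ.* suc f → X ℕ.* suc f ℕ.* b ≡ suc ((Y ℕ.* suc f ℕ.+ f) ℕ.* φ)
        flip e = ≡.trans (rearrange₁ X (suc f) b) (≡.trans e (rearrange₂ f Y))
          where
            rearrange₁ : ∀ X a b → X ℕ.* a ℕ.* b ≡ X ℕ.* b ℕ.* a
            rearrange₁ = solve-∀
            rearrange₂ : ∀ f Y → (suc f ℕ.+ Y ℕ.* suc (suc f)) ℕ.* suc f ≡ suc ((Y ℕ.* suc f ℕ.+ f) ℕ.* suc (suc f))
            rearrange₂ = solve-∀

    inverse-≡1 : ∀ m φ s X Y → m ∣ φ → X ℕ.* suc (s ℕ.* m) ≡ suc (Y ℕ.* φ) →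
                 (∃ λ t → X ≡ suc (t ℕ.* m)) × Coprime X φ
    inverse-≡1 m φ s zero Y m∣φ ()
    inverse-≡1 m φ s (suc X) Y m∣φ eq = (ℕD.quotient m∣X , ≡.cong suc (ℕD.m∣n⇒n≡quotient*m m∣X)) , X+1⊥φ
      where
        eq' : s ℕ.* m ℕ.+ X ℕ.* s ℕ.* m ℕ.+ X ≡ Y ℕ.* φ
        eq' = ≡.trans (rearrange s m X) (ℕP.suc-injective eq)
          where rearrange : ∀ s m X → s ℕ.* m ℕ.+ X ℕ.* s ℕ.* m ℕ.+ X ≡ s ℕ.* m ℕ.+ X ℕ.* suc (s ℕ.* m)
                rearrange = solve-∀
        m∣X : m ∣ X
        m∣X = ∣m+n∣m⇒∣n (subst (m ∣_) (≡.sym eq') (∣n⇒∣m*n Y m∣φ))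
                        (subst (m ∣_) (split s m X) (n∣m*n (s ℕ.+ X ℕ.* s)))
          where split : ∀ s m X → (s ℕ.+ X ℕ.* s) ℕ.* m ≡ s ℕ.* m ℕ.+ X ℕ.* s ℕ.* m
                split = solve-∀
        X+1⊥φ : Coprime (suc X) φ
        X+1⊥φ {i} (i∣X+1 , i∣φ) = ∣1⇒≡1 (∣m+n∣m⇒∣n {m = Y ℕ.* φ}
          (subst (i ∣_) (≡.trans eq (ℕP.+-comm 1 (Y ℕ.* φ))) (∣m⇒∣m*n (suc (s ℕ.* m)) i∣X+1)) (∣n⇒∣m*n Y i∣φ))

    ≡1-* : ∀ t s m → suc (t ℕ.* m) ℕ.* suc (s ℕ.* m) ≡ suc ((s ℕ.+ t ℕ.* suc (s ℕ.* m)) ℕ.* m)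
    ≡1-* = solve-∀

  module ThinOrbit {c ℓ : Level} (R : CommutativeRing c ℓ) (φ m : ℕ) (2≤φ : 2 ℕ.≤ φ) (m∣φ : m ℕD.∣ φ)
                   (χ0 : ℤ → CommutativeRing.Carrier R)
                   (χ0-roots : ∀ x → RingFacts.RootOrZero R φ (χ0 x)) where
    open CommutativeRing R
    open RingFacts R
    open Residues
    open import Data.Nat.Coprimality using (Coprime)
    open import Relation.Binary.Reasoning.Setoid setoid
    open import Function.Indexed.Relation.Binary.Equality using (≡-setoid)
    import Relation.Binary.Indexed.Heterogeneous.Construct.Trivial as Trivial
    open import Data.List.Properties using (map-∘)
    import Data.List.Relation.Unary.Any.Properties as Anyₚ
    import Data.List.Relation.Unary.All.Properties as Allₚ
    import Data.List.Relation.Unary.AllPairs.Properties as AllPairsₚ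
    open import Data.List.Relation.Binary.Permutation.Setoid.Properties setoid using (foldr-commMonoid)

    Thin : ℕ → Set
    Thin a = Coprime a φ × ∃ λ t → a ≡ suc (t ℕ.* m)

    InOrbit : (ℤ → Carrier) → Set ℓ
    InOrbit ψ = ∃ λ a → Thin a × _≈χ_ R ψ (galAct R a χ0)

    thin-* : ∀ {a b} → Thin a → Thin b → Thin (a ℕ.* b)
    thin-* (a⊥φ , t , ≡.refl) (b⊥φ , s , ≡.refl) = coprime-*ˡ a⊥φ b⊥φ , s ℕ.+ t ℕ.* suc (s ℕ.* m) , ≡1-* t s m

    thin-inverse : ∀ {b} → Thin b → ∃ λ X → ∃ λ Y → X ℕ.* b ≡ suc (Y ℕ.* φ) × Thin X
    thin-inverse {b} (b⊥φ , s , b≡) with invertible b φ 2≤φ b⊥φ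
    ... | X , Y , Xb≡ with inverse-≡1 m φ s X Y m∣φ (≡.subst (λ b → X ℕ.* b ≡ suc (Y ℕ.* φ)) b≡ Xb≡)
    ... | X≡1 , X⊥φ = X , Y , Xb≡ , (X⊥φ , X≡1)

    orbit-roots : ∀ {ψ} → InOrbit ψ → ∀ x → RootOrZero φ (ψ x)
    orbit-roots (a , (_ , t , ≡.refl) , ψ≈) x = root-resp {φ} (sym (ψ≈ x)) (root-power {φ} (χ0-roots x) (t ℕ.* m))

    act-closed : ∀ {ψ b} → InOrbit ψ → Thin b → InOrbit (galAct R b ψ)
    act-closed {ψ} {b} (a , thin-a , ψ≈) thin-b =
      a ℕ.* b , thin-* thin-a thin-b , λ x → trans (pow-cong b (ψ≈ x)) (pow-assoc (χ0 x) a b)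

    act-undo : ∀ {ψ} → InOrbit ψ → ∀ a b Y → a ℕ.* b ≡ suc (Y ℕ.* φ) → _≈χ_ R (galAct R a (galAct R b ψ)) ψ
    act-undo {ψ} oψ a b Y ab≡ x = begin
      pow R (pow R (ψ x) b) a     ≈⟨ pow-assoc (ψ x) b a ⟩
      pow R (ψ x) (b ℕ.* a)       ≡⟨ ≡.cong (pow R (ψ x)) (≡.trans (ℕP.*-comm b a) ab≡) ⟩
      pow R (ψ x) (suc (Y ℕ.* φ)) ≈⟨ root-fixed (orbit-roots oψ x) Y ⟩
      ψ x                         ∎

    χ-setoid : Setoid _ _
    χ-setoid = ≡-setoid ℤ (Trivial.indexedSetoid setoid)

    open import Data.List.Membership.Setoid χ-setoid using (_∈_)
    open import Data.List.Relation.Binary.Permutation.Setoid.Properties χ-setoid using (map⁺)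
    open SameMembers χ-setoid using (same-members-↭)

    -- For b ∈ H, Σ_{ψ ∈ O} ψ(n) = Σ_{ψ ∈ O} ψ(n)^b when O lists the orbit without
    -- repetition: ψ ↦ ψ^b permutes the orbit.
    orbit-sum-invariant : ∀ {O} → All InOrbit O → (∀ ψ → InOrbit ψ → Any (λ φ → _≈χ_ R φ ψ) O) →
                          AllPairs (λ φ ψ → ¬ _≈χ_ R φ ψ) O → ∀ {b} → Thin b → ∀ n →
                          listSum (λ ψ → ψ n) O ≈ listSum (λ ψ → pow R (ψ n) b) O
    orbit-sum-invariant {O} all-O cover distinct {b} thin-b n = begin
        foldr _+_ 0# (map (λ ψ → ψ n) O)
      ≈⟨ foldr-commMonoid +-isCommutativeMonoid (map⁺ setoid (λ ψ≈ψ' → ψ≈ψ' n) O↭σO) ⟩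
        foldr _+_ 0# (map (λ ψ → ψ n) (map σ O))
      ≡⟨ ≡.cong (foldr _+_ 0#) (≡.sym (map-∘ O)) ⟩
        listSum (λ ψ → pow R (ψ n) b) O ∎
      where
        σ = galAct R b
        open Σ (thin-inverse thin-b) renaming (proj₁ to X; proj₂ to rest)
        Y = proj₁ rest
        Xb≡ = proj₁ (proj₂ rest)
        thin-X = proj₂ (proj₂ rest)
        σ-injective : ∀ {φ ψ} → InOrbit φ → InOrbit ψ → _≈χ_ R (σ φ) (σ ψ) → _≈χ_ R φ ψ
        σ-injective oφ oψ σφ≈σψ x =
          trans (sym (act-undo oφ X b Y Xb≡ x)) (trans (pow-cong X (σφ≈σψ x)) (act-undo oψ X b Y Xb≡ x))
        distinct-image : ∀ {xs} → All InOrbit xs → AllPairs (λ φ ψ → ¬ _≈χ_ R φ ψ) xs →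
                         AllPairs (λ φ ψ → ¬ _≈χ_ R (σ φ) (σ ψ)) xs
        distinct-image [] [] = []
        distinct-image (oφ ∷ os) (φ≉ ∷ distinct) =
          All.zipWith (λ (oψ , φ≉ψ) σφ≈σψ → φ≉ψ (σ-injective oφ oψ σφ≈σψ)) (os , φ≉) ∷ distinct-image os distinct
        O⊆σO : All (_∈ map σ O) O
        O⊆σO = All.map (λ {ψ} oψ → Anyₚ.map⁺ (Any.map (λ {φ} φ≈ψ' x →
                   trans (sym (act-undo oψ b X Y (≡.trans (ℕP.*-comm b X) Xb≡) x)) (pow-cong b (sym (φ≈ψ' x))))
                 (cover (galAct R X ψ) (act-closed oψ thin-X)))) all-O
        σO⊆O : All (_∈ O) (map σ O)
        σO⊆O = Allₚ.map⁺ (All.map (λ oφ → Any.map (λ ψ≈σφ x → sym (ψ≈σφ x)) (cover _ (act-closed oφ thin-b))) all-O)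
        O↭σO = same-members-↭ distinct (AllPairsₚ.map⁺ (distinct-image all-O distinct)) O⊆σO σO⊆O

-- Dirichlet characters modulo p^k and the averaging argument.
module PrimePowerCharacters where

  open IntegerArithmetic
  open RingsAndOrbits
  open import Data.Nat using (zero; suc)
  import Data.Nat.Properties as ℕP
  open import Data.Nat.Primality using (prime⇒nonTrivial)
  open import Data.Integer using (-[1+_]; _^_; 1ℤ)
  import Data.Integer.Properties as ℤP
  open import Data.Integer.Divisibility.Signed using (_∣_; _∣?_; divides; ∣ᵤ⇒∣; ∣⇒∣ᵤ)
  open import Data.Integer.Tactic.RingSolver using (solve-∀)
  open import Data.Nat.Tactic.RingSolver using () renaming (solve-∀ to ℕ-solve-∀)
  open import Data.Product using (Σ; _,_; proj₁; proj₂)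
  open import Data.Fin using (toℕ)
  open import Data.List.Relation.Unary.All as All using (All)
  open import Data.Sum using (inj₁; inj₂)
  open import Relation.Nullary using (yes; no)
  open import Relation.Binary.PropositionalEquality as ≡ using (_≡_)

  periodic-step : ∀ b m Q → b ℤ.+ (1ℤ ℤ.+ m) ℤ.* Q ≡ b ℤ.+ m ℤ.* Q ℤ.+ Q
  periodic-step = solve-∀

  periodic-back : ∀ b N Q → b ℤ.+ (ℤ.- N) ℤ.* Q ℤ.+ N ℤ.* Q ≡ b
  periodic-back = solve-∀

  module DirichletCharacter {c ℓ : Level} (R : CommutativeRing c ℓ) (p : ℕ) (p-prime : Prime p) (2<p : 2 ℕ.< p)
                            (k : ℕ) (χ : ℤ → CommutativeRing.Carrier R) (dirichlet : IsDirichletChar R p (suc k) χ) where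
    open CommutativeRing R
    open RingFacts R
    open OddPrimePowers p p-prime 2<p
    open import Relation.Binary.Reasoning.Setoid setoid

    Q : ℤ
    Q = + (p ℕ.^ suc k)

    φ : ℕ
    φ = phiPrimePower p (suc k)

    χ-cong : ∀ {a b} → a ≡ b → χ a ≈ χ b
    χ-cong a≡b = reflexive (≡.cong χ a≡b)

    χ-periodic : ∀ a → χ (a ℤ.+ Q) ≈ χ a
    χ-periodic = proj₁ dirichlet

    χ-multiplicative : ∀ a b → χ (a ℤ.* b) ≈ χ a * χ b
    χ-multiplicative = proj₁ (proj₂ dirichlet)

    χ-one : χ 1ℤ ≈ 1#
    χ-one = proj₁ (proj₂ (proj₂ dirichlet))

    χ-vanishes : ∀ x → P ∣ x → χ x ≈ 0#
    χ-vanishes x P∣x = proj₁ (proj₂ (proj₂ (proj₂ dirichlet))) x (∣⇒∣ᵤ P∣x)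

    χ-shift-ℕ : ∀ b m → χ (b ℤ.+ + m ℤ.* Q) ≈ χ b
    χ-shift-ℕ b zero = χ-cong (≡.trans (≡.cong (λ t → b ℤ.+ t) (ℤP.*-zeroˡ Q)) (ℤP.+-identityʳ b))
    χ-shift-ℕ b (suc m) = trans (χ-cong (≡.trans (≡.cong (λ t → b ℤ.+ t ℤ.* Q) (ℤP.pos-+ 1 m)) (periodic-step b (+ m) Q)))
                                (trans (χ-periodic (b ℤ.+ + m ℤ.* Q)) (χ-shift-ℕ b m))

    χ-shift : ∀ b e → χ (b ℤ.+ e ℤ.* Q) ≈ χ b
    χ-shift b (+ m) = χ-shift-ℕ b m
    χ-shift b -[1+ m ] = sym (trans (χ-cong (≡.sym (periodic-back b (+ suc m) Q))) (χ-shift-ℕ (b ℤ.+ -[1+ m ] ℤ.* Q) (suc m)))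

    χ-congruence : ∀ a b → Q ∣ a ℤ.- b → χ a ≈ χ b
    χ-congruence a b (divides e a-b≡) = trans (χ-cong (≡.trans (move-left {a} {c = b} a-b≡) (ℤP.+-comm (e ℤ.* Q) b))) (χ-shift b e)

    χ-pow : ∀ a s → χ (a ^ s) ≈ pow R (χ a) s
    χ-pow a zero = χ-one
    χ-pow a (suc s) = trans (χ-multiplicative a (a ^ s)) (*-congˡ (χ-pow a s))

    -- By Euler's theorem, the values of χ at units are φ-th roots of unity.
    χ-root : ∀ x → ¬ P ∣ x → pow R (χ x) φ ≈ 1#
    χ-root x P∤x = begin
      pow R (χ x) φ    ≈⟨ sym (χ-pow x φ) ⟩
      χ (x ^ φ)        ≈⟨ χ-congruence (x ^ φ) 1ℤ (≡.subst (_∣ x ^ φ ℤ.- 1ℤ) (≡.sym (pos-^ p (suc k))) (euler k x P∤x)) ⟩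
      χ 1ℤ             ≈⟨ χ-one ⟩
      1#               ∎

    χ-roots : ∀ x → RootOrZero φ (χ x)
    χ-roots x with P ∣? x
    ... | yes P∣x = inj₁ (χ-vanishes x P∣x)
    ... | no P∤x = inj₂ (χ-root x P∤x)

  exponent-swap : ∀ a b c → a ℕ.* c ℕ.* b ≡ a ℕ.* b ℕ.* c
  exponent-swap = ℕ-solve-∀

  exponent-inverse : ∀ a M X Y φ → X ℕ.* a ≡ suc (Y ℕ.* φ) → M ℕ.+ M ℕ.* Y ℕ.* φ ≡ a ℕ.* M ℕ.* X
  exponent-inverse a M X Y φ Xa≡ = ≡.sym (≡.trans (regroup a M X) (≡.trans (≡.cong (M ℕ.*_) Xa≡) (expand M Y φ)))
    where
      regroup : ∀ a M X → a ℕ.* M ℕ.* X ≡ M ℕ.* (X ℕ.* a)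
      regroup = ℕ-solve-∀
      expand : ∀ M Y φ → M ℕ.* suc (Y ℕ.* φ) ≡ M ℕ.+ M ℕ.* Y ℕ.* φ
      expand = ℕ-solve-∀

  ^-∣-^ : ∀ p {a b} → a ℕ.≤ b → p ℕ.^ a ℕD.∣ p ℕ.^ b
  ^-∣-^ p {a} a≤b with ℕP.m≤n⇒∃[o]m+o≡n a≤b
  ... | o , a+o≡b = ℕD.divides (p ℕ.^ o) (≡.trans (≡.cong (p ℕ.^_) (≡.sym a+o≡b))
                      (≡.trans (ℕP.^-distribˡ-+-* p a o) (ℕP.*-comm (p ℕ.^ a) (p ℕ.^ o))))

  odd-prime>2 : ∀ {p} → Prime p → ¬ 2 ℕD.∣ p → 2 ℕ.< p
  odd-prime>2 {p} p-prime 2∤p = ℕP.≤∧≢⇒< (ℕ.nonTrivial⇒n>1 p {{prime⇒nonTrivial p-prime}})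
                                          (λ 2≡p → 2∤p (≡.subst (2 ℕD.∣_) 2≡p ℕD.∣-refl))

  module PrimitiveCharacter {c ℓ : Level} (R : CommutativeRing c ℓ) (p : ℕ) (p-prime : Prime p) (2<p : 2 ℕ.< p)
                            (k : ℕ) (χ : ℤ → CommutativeRing.Carrier R) (χ-primitive : IsPrimitiveChar R p (suc (suc k)) χ) where
    open CommutativeRing R
    open RingFacts R
    open OddPrimePowers p p-prime 2<p
    open DirichletCharacter R p p-prime 2<p (suc k) χ (proj₁ χ-primitive) public
    open import Relation.Binary.Reasoning.Setoid setoid

    -- Any g ≡ 1 + p^(k+1) w with p ∤ w generates (1 + p^(k+1) ℤ) mod p^(k+2); as χ
    -- is primitive it is not trivial there, so χ(g) ≠ 1.
    χ-nontrivial-at : ∀ g w → ¬ P ∣ w → g ≡ 1ℤ ℤ.+ P ^ suc k ℤ.* w → ¬ χ g ≈ 1#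
    χ-nontrivial-at g w P∤w g≡ χg≈1 = proj₂ χ-primitive (suc k) (ℕP.n<1+n (suc k)) trivial-on-kernel
      where
        trivial-on-kernel : ∀ x → ¬ (+ p) ℤD.∣ x → (+ (p ℕ.^ suc k)) ℤD.∣ (x ℤ.- + 1) → χ x ≈ 1#
        trivial-on-kernel x _ p^[k+1]∣x-1 = begin
            χ x           ≈⟨ χ-congruence x (g ^ s) (≡.subst (_∣ x ℤ.- g ^ s) (≡.sym (pos-^ p (suc (suc k)))) P^[k+2]∣x-g^s) ⟩
            χ (g ^ s)     ≈⟨ χ-pow g s ⟩
            pow R (χ g) s ≈⟨ pow-cong s χg≈1 ⟩
            pow R 1# s    ≈⟨ pow-one s ⟩
            1#            ∎
          where
            generated = kernel-cyclic k g w P∤w g≡ x (≡.subst (_∣ x ℤ.- 1ℤ) (pos-^ p (suc k)) (∣ᵤ⇒∣ p^[k+1]∣x-1))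
            s = proj₁ generated
            P^[k+2]∣x-g^s = proj₂ generated

    -- If p ∤ n and p^(K+1) ∤ n^(p-1) - 1, where r + K = k, then χ(n)^M ≠ 1 for
    -- M = p^(r+1) (p-1): a p-power of n^M is such a generator g.
    χ-nontrivial : ∀ K r → r ℕ.+ K ≡ k → ∀ n → ¬ P ∣ n → ¬ P ^ suc K ∣ n ^ (p ∸ 1) ℤ.- 1ℤ →
                   ¬ pow R (χ n) (p ℕ.^ suc r ℕ.* (p ∸ 1)) ≈ 1#
    χ-nontrivial K r r+K≡k n P∤n P^[K+1]∤ χn^M≈1 = χ-nontrivial-at g w P∤w g≡ χg≈1
      where
        M = p ℕ.^ suc r ℕ.* (p ∸ 1)
        open Σ (kernel-generator K r n P∤n P^[K+1]∤) renaming (proj₁ to d; proj₂ to rest)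
        w = proj₁ rest
        P∤w = proj₁ (proj₂ rest)
        exponent = p ℕ.^ (suc r ℕ.+ d) ℕ.* (p ∸ 1)
        g = n ^ exponent
        g≡ : g ≡ 1ℤ ℤ.+ P ^ suc k ℤ.* w
        g≡ = ≡.trans (proj₂ (proj₂ rest)) (≡.cong (λ e → 1ℤ ℤ.+ P ^ suc e ℤ.* w) r+K≡k)
        exponent≡ : exponent ≡ M ℕ.* p ℕ.^ d
        exponent≡ = ≡.trans (≡.cong (ℕ._* (p ∸ 1)) (ℕP.^-distribˡ-+-* p (suc r) d))
                            (exponent-swap (p ℕ.^ suc r) (p ∸ 1) (p ℕ.^ d))
        χg≈1 : χ g ≈ 1#
        χg≈1 = begin
          χ g                            ≈⟨ χ-pow n exponent ⟩
          pow R (χ n) exponent           ≡⟨ ≡.cong (pow R (χ n)) exponent≡ ⟩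
          pow R (χ n) (M ℕ.* p ℕ.^ d)    ≈⟨ sym (pow-assoc (χ n) M (p ℕ.^ d)) ⟩
          pow R (pow R (χ n) M) (p ℕ.^ d) ≈⟨ pow-cong (p ℕ.^ d) χn^M≈1 ⟩
          pow R 1# (p ℕ.^ d)             ≈⟨ pow-one (p ℕ.^ d) ⟩
          1#                             ∎

  -- The thin orbit O_κ of a primitive character χ0 modulo p^k, k = k2 + 2 and
  -- κ = κ' + 1, and the vanishing of Σ_{ψ ∈ O_κ} ψ(n).
  module ThinOrbitSum {c ℓ : Level} (R : CommutativeRing c ℓ) (domain : IsIntegralDomain R) (char-zero : CharZero R)
                      (p : ℕ) (p-prime : Prime p) (2<p : 2 ℕ.< p) (k2 κ' : ℕ)
                      (χ0 : ℤ → CommutativeRing.Carrier R) (χ0-primitive : IsPrimitiveChar R p (suc (suc k2)) χ0) where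
    open CommutativeRing R
    open RingFacts R
    open Domain domain char-zero
    open OddPrimePowers p p-prime 2<p
    open PrimitiveCharacter R p p-prime 2<p k2 χ0 χ0-primitive
    open Residues
    open import Algebra.Properties.Semiring.Sum semiring using (sum; sum-replicate; sum-cong-≋; *-distribˡ-sum)
    open import Relation.Binary.Reasoning.Setoid setoid

    -- The exponents of the argument: the thin subgroup is 1 + mℤ, and we
    -- average over the L elements 1 + jM, j < L, of it, where M L = φ.
    K r m M L : ℕ
    K = suc κ' ℕ.⊓ k2
    r = k2 ∸ K
    m = p ℕ.^ (k2 ∸ κ') ℕ.* (p ∸ 1)
    M = p ℕ.^ suc r ℕ.* (p ∸ 1)
    L = p ℕ.^ K

    K≤k2 : K ℕ.≤ k2
    K≤k2 = ℕP.m⊓n≤n (suc κ') k2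

    r+K≡k2 : r ℕ.+ K ≡ k2
    r+K≡k2 = ℕP.m∸n+n≡m K≤k2

    M*L≡φ : M ℕ.* L ≡ φ
    M*L≡φ = ≡.trans (exponent-swap (p ℕ.^ suc r) L (p ∸ 1))
              (≡.cong (ℕ._* (p ∸ 1)) (≡.trans (≡.sym (ℕP.^-distribˡ-+-* p (suc r) K))
                                              (≡.cong (λ e → p ℕ.^ suc e) r+K≡k2)))

    2≤φ : 2 ℕ.≤ φ
    2≤φ = ℕP.*-mono-≤ {1} {p ℕ.^ suc k2} (ℕP.m^n>0 p (suc k2)) (ℕP.∸-monoˡ-≤ 1 2<p)

    m∣φ : m ℕD.∣ φ
    m∣φ = ℕD.*-monoˡ-∣ (p ∸ 1) (^-∣-^ p (ℕP.≤-trans (ℕP.m∸n≤m k2 κ') (ℕP.n≤1+n k2)))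

    m∣M : m ℕD.∣ M
    m∣M = ℕD.*-monoˡ-∣ (p ∸ 1) (^-∣-^ p (ℕP.≤-trans (ℕP.∸-monoʳ-≤ (suc k2) (ℕP.m⊓n≤m (suc κ') k2))
                                                     (ℕP.≤-reflexive (ℕP.+-∸-assoc 1 K≤k2))))

    open ThinOrbit R φ m 2≤φ m∣φ χ0 χ-roots

    -- Each 1 + jM lies in the thin subgroup: it is ≡ 1 mod m, and prime to p
    -- and to p - 1, which both divide M.
    thin-1+jM : ∀ j → Thin (suc (j ℕ.* M))
    thin-1+jM j = coprime-*ʳ (coprime-^ʳ (coprime-1+ j M p p∣M) (suc k2)) (coprime-1+ j M (p ∸ 1) p-1∣M) ,
                  j ℕ.* ℕD.quotient m∣M , ≡.cong suc 1+jM≡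
      where
        p∣M = ℕD.∣-trans (ℕD.m∣m*n (p ℕ.^ r)) (ℕD.m∣m*n (p ∸ 1))
        p-1∣M = ℕD.n∣m*n (p ℕ.^ suc r)
        1+jM≡ = ≡.trans (≡.cong (j ℕ.*_) (ℕD.m∣n⇒n≡quotient*m m∣M)) (≡.sym (ℕP.*-assoc j _ m))

    -- Along the orbit ψ = χ0^a with a invertible mod φ, so ψ(n)^M = 1 would
    -- force χ0(n)^M = 1.
    orbit-nontrivial : ∀ n → ¬ P ∣ n → ¬ pow R (χ0 n) M ≈ 1# → ∀ {ψ} → InOrbit ψ → ¬ pow R (ψ n) M ≈ 1#
    orbit-nontrivial n P∤n χ0n^M≉1 {ψ} (a , thin-a , ψ≈) ψn^M≈1 = χ0n^M≉1 (begin
        pow R ζ M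
      ≈⟨ sym (root-period (χ-root n P∤n) M (M ℕ.* Y)) ⟩
        pow R ζ (M ℕ.+ M ℕ.* Y ℕ.* φ)
      ≡⟨ ≡.cong (pow R ζ) (exponent-inverse a M X Y φ Xa≡) ⟩
        pow R ζ (a ℕ.* M ℕ.* X)
      ≈⟨ sym (trans (pow-cong X (pow-assoc ζ a M)) (pow-assoc ζ (a ℕ.* M) X)) ⟩
        pow R (pow R (pow R ζ a) M) X
      ≈⟨ pow-cong X (trans (pow-cong M (sym (ψ≈ n))) ψn^M≈1) ⟩
        pow R 1# X
      ≈⟨ pow-one X ⟩
        1# ∎)
      where
        ζ = χ0 n
        open Σ (thin-inverse thin-a) renaming (proj₁ to X; proj₂ to rest)
        Y = proj₁ rest
        Xa≡ = proj₁ (proj₂ rest)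

    -- Averaging ψ(n) over the exponents 1 + jM, j < L, gives
    -- ψ(n) Σ_{j<L} (ψ(n)^M)^j = 0, as ψ(n)^M ≠ 1 is an L-th root of unity.
    orbit-average-vanishes : ∀ n → ¬ P ∣ n → ¬ pow R (χ0 n) M ≈ 1# → ∀ {ψ} → InOrbit ψ →
                             sum {L} (λ j → pow R (ψ n) (suc (toℕ j ℕ.* M))) ≈ 0#
    orbit-average-vanishes n P∤n χ0n^M≉1 {ψ} oψ = begin
        sum {L} (λ j → pow R x (suc (toℕ j ℕ.* M)))
      ≈⟨ sum-cong-≋ {L} (λ j → *-congˡ (trans (reflexive (≡.cong (pow R x) (ℕP.*-comm (toℕ j) M)))
                                               (sym (pow-assoc x M (toℕ j))))) ⟩
        sum {L} (λ j → x * pow R (pow R x M) (toℕ j))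
      ≈⟨ sym (*-distribˡ-sum {L} x _) ⟩
        x * geometric (pow R x M) L
      ≈⟨ vanish (orbit-roots oψ n) ⟩
        0# ∎
      where
        x = ψ n
        vanish : RootOrZero φ x → x * geometric (pow R x M) L ≈ 0#
        vanish (inj₁ x≈0) = trans (*-congʳ x≈0) (zeroˡ _)
        vanish (inj₂ x^φ≈1) = trans (*-congˡ (geometric-vanishes (pow R x M) L x^M^L≈1 (orbit-nontrivial n P∤n χ0n^M≉1 oψ)))
                                    (zeroʳ x)
          where x^M^L≈1 = trans (pow-assoc x M L) (trans (reflexive (≡.cong (pow R x) M*L≡φ)) x^φ≈1)

    -- The main argument: for p ∤ n, L Σ_{ψ ∈ O} ψ(n) = Σ_{j<L} Σ_{ψ ∈ O} ψ(n)^(1+jM)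
    -- = Σ_{ψ ∈ O} Σ_{j<L} ψ(n)^(1+jM) = 0; for p ∣ n every term vanishes.
    thin-orbit-sum-vanishes : ∀ {O} → EnumeratesThinOrbit R p (suc (suc k2)) (suc κ') χ0 O →
                              ∀ n → ¬ (+ (p ℕ.^ (K ℕ.+ 1))) ℤD.∣ (n ^ (p ∸ 1) ℤ.- + 1) → sumAt R O n ≈ 0#
    thin-orbit-sum-vanishes {O} (all-O , cover , distinct) n p^[K+1]∤ with P ∣? n
    ... | yes P∣n = listSum-zero (All.map value-zero all-O)
      where value-zero : ∀ {ψ} → InOrbit ψ → ψ n ≈ 0#
            value-zero (a , (_ , t , ≡.refl) , ψ≈) = trans (ψ≈ n) (trans (*-congʳ (χ-vanishes n P∣n)) (zeroˡ _))
    ... | no P∤n = natCast-cancel L S (begin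
        natCast R L * S
      ≈⟨ sym (trans (sum-replicate L) (natCast-* L S)) ⟩
        sum {L} (λ _ → S)
      ≈⟨ sum-cong-≋ {L} (λ j → orbit-sum-invariant all-O cover distinct (thin-1+jM (toℕ j)) n) ⟩
        sum {L} (λ j → listSum (λ ψ → pow R (ψ n) (suc (toℕ j ℕ.* M))) O)
      ≈⟨ sum-listSum L (λ j ψ → pow R (ψ n) (suc (toℕ j ℕ.* M))) O ⟩
        listSum (λ ψ → sum {L} (λ j → pow R (ψ n) (suc (toℕ j ℕ.* M)))) O
      ≈⟨ listSum-zero (All.map (orbit-average-vanishes n P∤n (χ-nontrivial K r r+K≡k2 n P∤n P^[K+1]∤)) all-O) ⟩
        0# ∎)
      where
        S = sumAt R O n
        P^[K+1]∤ : ¬ P ^ suc K ∣ n ^ (p ∸ 1) ℤ.- 1ℤ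
        P^[K+1]∤ P^[K+1]∣ = p^[K+1]∤ (≡.subst (λ e → + (p ℕ.^ e) ℤD.∣ n ^ (p ∸ 1) ℤ.- 1ℤ) (ℕP.+-comm 1 K)
                                       (≡.subst (ℤD._∣ n ^ (p ∸ 1) ℤ.- 1ℤ) (≡.sym (pos-^ p (suc K))) (∣⇒∣ᵤ P^[K+1]∣)))
        instance L-nonZero = ℕP.m^n≢0 p K

open PrimePowerCharacters using (odd-prime>2; module ThinOrbitSum)

lemma3p1 : ∀ {c ℓ : Level} (R : CommutativeRing c ℓ) →
    IsIntegralDomain R → CharZero R →
    ∀ (p k κ : ℕ) → Prime p → ¬ (2 ℕD.∣ p) →
    (ξ : CommutativeRing.Carrier R) →
    IsPrimitiveRootOfUnity R (phiPrimePower p k) ξ →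
    0 < κ → κ < k →
    (χ0 : ℤ → CommutativeRing.Carrier R) → IsPrimitiveChar R p k χ0 →
    (O : List (ℤ → CommutativeRing.Carrier R)) → EnumeratesThinOrbit R p k κ χ0 O →
    (n : ℤ) →
    ¬ ((+ (p ℕ.^ ((κ ⊓ (k ∸ 2)) ℕ.+ 1))) ℤD.∣ ((n ℤ.^ (p ∸ 1)) ℤ.- + 1)) →
    CommutativeRing._≈_ R (sumAt R O n) (CommutativeRing.0# R)
lemma3p1 R domain char-zero p (ℕ.suc (ℕ.suc k2)) (ℕ.suc κ') p-prime p-odd _ _ _ _ χ0 χ0-primitive O enumeration n =
  ThinOrbitSum.thin-orbit-sum-vanishes R domain char-zero p p-prime (odd-prime>2 p-prime p-odd) k2 κ'
    χ0 χ0-primitive enumeration n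
lemma3p1 R _ _ p ℕ.zero κ _ _ _ _ _ () _ _ _ _ _
lemma3p1 R _ _ p (ℕ.suc ℕ.zero) ℕ.zero _ _ _ _ () _ _ _ _ _ _
lemma3p1 R _ _ p (ℕ.suc ℕ.zero) (ℕ.suc κ) _ _ _ _ _ (ℕ.s≤s ()) _ _ _ _ _
lemma3p1 R _ _ p (ℕ.suc (ℕ.suc k2)) ℕ.zero _ _ _ _ () _ _ _ _ _ _
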